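{- For all integers $n,k\ge 1$ there is a bijection between $\mathcal{L}_{n,k}(12\cdots(k+1))$ and the set of standard Young tableaux of rectangular shape $\langle k^n\rangle$ (the shape with $n$ rows, each of length $k$). In particular $|\mathcal{L}_{n,k}(12\cdots(k+1))| = f^{\langle k^n\rangle}$, the number of standard Young tableaux of shape $\langle k^n\rangle$.
   Context: A word $w$ contains a pattern $p\in S_m$ if some subsequence of $w$ of length $m$ is order-isomorphic to $p$; otherwise $w$ avoids $p$. For a set $S$ of permutations, $S(p)$ denotes the set of elements of $S$ avoiding $p$. For $n,k\ge 1$, $\mathcal{L}_{n,k}\subseteq S_{nk}$ is the set of permutations $w=w_{1,1}w_{1,2}\cdots w_{1,k}w_{2,1}\cdots w_{n,k}$ (written in $n$ consecutive blocks of length $k$) such that (L1) $w_{i,j}<w_{i,j+1}$ for all $1\le i\le n$, $1\le j\le k-1$, and (L2) $w_{i,j+1}>w_{i+1,j}$ for all $1\le i\le n-1$, $1\le j\le k-1$. -}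

module Defs where

open import Data.Nat using (ℕ; zero; suc; _*_; _<_; _≤_; _>_)
open import Data.Fin using (Fin; toℕ; combine)
open import Data.Vec using (Vec; lookup; tabulate)
open import Data.Product using (Σ; ∃; _×_; proj₁)
open import Function.Bundles using (_⇔_)
open import Relation.Nullary using (¬_)
open import Relation.Binary.PropositionalEquality using (_≡_)

IsPerm : (N : ℕ) → Vec ℕ N → Set
IsPerm N w = (∀ (i : Fin N) → 1 ≤ lookup w i × lookup w i ≤ N)
           × (∀ (i j : Fin N) → lookup w i ≡ lookup w j → i ≡ j)

Contains : {N m : ℕ} → Vec ℕ N → Vec ℕ m → Set
Contains {N} {m} w p =
  Σ (Fin m → Fin N) λ ι →
      (∀ (a b : Fin m) → toℕ a < toℕ b → toℕ (ι a) < toℕ (ι b))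
    × (∀ (a b : Fin m) → (lookup w (ι a) < lookup w (ι b)) ⇔ (lookup p a < lookup p b))

Avoids : {N m : ℕ} → Vec ℕ N → Vec ℕ m → Set
Avoids w p = ¬ Contains w p

idPattern : (m : ℕ) → Vec ℕ m
idPattern m = tabulate (λ i → suc (toℕ i))

-- Entry w_{i,j} (block i, position j within the block), 0-based indices:
-- position i*k + j in the one-line notation.
entry : (n k : ℕ) → Vec ℕ (n * k) → Fin n → Fin k → ℕ
entry n k w i j = lookup w (combine i j)

InL : (n k : ℕ) → Vec ℕ (n * k) → Set
InL n k w =
    IsPerm (n * k) w
  × (∀ (i : Fin n) (j j' : Fin k) → toℕ j' ≡ suc (toℕ j) →
       entry n k w i j < entry n k w i j')
  × (∀ (i i' : Fin n) (j j' : Fin k) → toℕ i' ≡ suc (toℕ i) → toℕ j' ≡ suc (toℕ j) →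
       entry n k w i j' > entry n k w i' j)

InLAvoid : (n k : ℕ) → Vec ℕ (n * k) → Set
InLAvoid n k w = InL n k w × Avoids w (idPattern (suc k))

IsSYTRect : (n k : ℕ) → Vec (Vec ℕ k) n → Set
IsSYTRect n k T =
    (∀ (i : Fin n) (j : Fin k) → 1 ≤ cell i j × cell i j ≤ n * k)
  × (∀ (i i' : Fin n) (j j' : Fin k) → cell i j ≡ cell i' j' → (i ≡ i' × j ≡ j'))
  × (∀ (i : Fin n) (j j' : Fin k) → toℕ j < toℕ j' → cell i j < cell i j')
  × (∀ (i i' : Fin n) (j : Fin k) → toℕ i < toℕ i' → cell i j < cell i' j)
  where
    cell : Fin n → Fin k → ℕ
    cell i j = lookup (lookup T i) j

-- A bijection between the subsets {x ∈ A | P x} and {y ∈ B | Q y}.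
-- Since membership is a proposition, the inverse laws are stated on the
-- underlying elements.
record SubsetBijection {A B : Set} (P : A → Set) (Q : B → Set) : Set where
  field
    to       : Σ A P → Σ B Q
    from     : Σ B Q → Σ A P
    from-to  : ∀ x → proj₁ (from (to x)) ≡ proj₁ x
    to-from  : ∀ y → proj₁ (to (from y)) ≡ proj₁ y

module Submission where

-- Read a word w of length nk as the n×k array E i j = w_{i,j} of its blocks,
-- and call w Ordered if E strictly increases along rows and strictly
-- decreases down columns.  The heart of the proof is the characterisation
--   w ∈ L_{n,k}(12⋯(k+1))  ⇔  w is an Ordered permutation.
-- ⇒: if E i j < E i' j for rows i < i', the hook
-- E i 0 < ⋯ < E i j < E i' j < ⋯ < E i' (k-1) is an occurrence of 12⋯(k+1).
-- ⇐: in an Ordered array an increasing pair of letters moves strictly to the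
-- right, so an occurrence of 12⋯(k+1) would be a strictly increasing map
-- Fin (k+1) → Fin k, which the pigeonhole principle forbids.
-- Reversing the rows of an Ordered permutation gives exactly an SYT.

open import Defs
open import Data.Nat using (ℕ; suc; _*_; _<_; _≤_; s≤s; s≤s⁻¹; _≤?_)
open import Data.Nat.Properties
  using (<-trans; <-asym; <-irrefl; <-cmp; ≤-<-trans; ≤-antisym; ≰⇒>; ≤⇒≯; suc-injective;
         n<1+n; m≤n⇒m<n∨m≡n; +-monoʳ-<; +-cancelˡ-<; ∸-monoʳ-<)
open import Data.Fin using (Fin; toℕ; suc; fromℕ<; combine; quotient; remainder; opposite)
import Data.Fin.Properties as Fin
open import Data.Fin.Properties
  using (toℕ-injective; toℕ<n; toℕ-fromℕ<; toℕ-combine; combine-monoˡ-<; combine-injective;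
         remQuot-combine; combine-remQuot; opposite-prop; opposite-involutive; pigeonhole)
open import Data.Vec using (Vec; lookup; tabulate)
open import Data.Vec.Properties using (lookup∘tabulate; tabulate∘lookup; tabulate-cong)
open import Data.Product using (Σ; _×_; _,_; proj₁; proj₂)
open import Data.Sum using (_⊎_; inj₁; inj₂)
open import Function.Bundles using (mk⇔; Equivalence)
open import Relation.Nullary using (¬_; yes; no; contradiction)
open import Relation.Binary using (tri<; tri≈; tri>)
open import Relation.Binary.PropositionalEquality
  using (_≡_; refl; sym; trans; cong; cong₂; subst; subst₂; module ≡-Reasoning)

private
  variable
    m n k N : ℕ

StrictlyIncreasing : (Fin m → ℕ) → Set
StrictlyIncreasing f = ∀ a b → toℕ a < toℕ b → f a < f b

increasing-by-steps : (f : Fin m → ℕ) →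
  (∀ a b → toℕ b ≡ suc (toℕ a) → f a < f b) → StrictlyIncreasing f
increasing-by-steps {m} f step a b a<b = go (toℕ b) b refl a<b
  where
  go : ∀ v (b : Fin m) → toℕ b ≡ v → toℕ a < v → f a < f b
  go (suc v) b b≡1+v a<1+v with m≤n⇒m<n∨m≡n (s≤s⁻¹ a<1+v)
  ... | inj₂ a≡v = step a b (trans b≡1+v (cong suc (sym a≡v)))
  ... | inj₁ a<v = <-trans (go v c (toℕ-fromℕ< v<m) a<v)
                           (step c b (trans b≡1+v (cong suc (sym (toℕ-fromℕ< v<m)))))
    where
    v<m : v < m
    v<m = <-trans (n<1+n v) (subst (_< m) b≡1+v (toℕ<n b))
    c : Fin m
    c = fromℕ< v<m

no-increasing-map : (c : Fin (suc k) → Fin k) → ¬ StrictlyIncreasing (λ a → toℕ (c a))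
no-increasing-map c increasing with pigeonhole (n<1+n _) c
... | a , b , a<b , ca≡cb = <-irrefl (cong toℕ ca≡cb) (increasing a b a<b)

consecutive⇒< : {a b : Fin m} → toℕ b ≡ suc (toℕ a) → toℕ a < toℕ b
consecutive⇒< {a = a} b≡1+a = subst (toℕ a <_) (sym b≡1+a) (n<1+n (toℕ a))

opposite-reverses : (a b : Fin m) → toℕ a < toℕ b → toℕ (opposite b) < toℕ (opposite a)
opposite-reverses a b a<b rewrite opposite-prop a | opposite-prop b = ∸-monoʳ-< (s≤s a<b) (toℕ<n b)

opposite-injective : {a b : Fin m} → opposite a ≡ opposite b → a ≡ b
opposite-injective {a = a} {b} e = begin
  a                     ≡⟨ sym (opposite-involutive a) ⟩
  opposite (opposite a) ≡⟨ cong opposite e ⟩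
  opposite (opposite b) ≡⟨ opposite-involutive b ⟩
  b                     ∎
  where open ≡-Reasoning

combine-monoʳ-< : (i : Fin n) (j j' : Fin k) → toℕ j < toℕ j' → toℕ (combine i j) < toℕ (combine i j')
combine-monoʳ-< {k = k} i j j' j<j' rewrite toℕ-combine i j | toℕ-combine i j' = +-monoʳ-< (k * toℕ i) j<j'

combine-lex : (i i' : Fin n) (j j' : Fin k) → toℕ (combine i j) < toℕ (combine i' j') →
  toℕ i < toℕ i' ⊎ (i ≡ i' × toℕ j < toℕ j')
combine-lex {k = k} i i' j j' before with Fin.<-cmp i i'
... | tri< i<i' _ _ = inj₁ i<i'
... | tri> _ _ i'<i = contradiction (combine-monoˡ-< j' j i'<i) (<-asym before)
... | tri≈ _ refl _ rewrite toℕ-combine i j | toℕ-combine i j' =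
  inj₂ (refl , +-cancelˡ-< (k * toℕ i) (toℕ j) (toℕ j') before)

lookup-idPattern : (a : Fin m) → lookup (idPattern m) a ≡ suc (toℕ a)
lookup-idPattern a = lookup∘tabulate (λ i → suc (toℕ i)) a

idPattern-order : (a b : Fin m) → lookup (idPattern m) a < lookup (idPattern m) b → toℕ a < toℕ b
idPattern-order a b lt = s≤s⁻¹ (subst₂ _<_ (lookup-idPattern a) (lookup-idPattern b) lt)

order-idPattern : (a b : Fin m) → toℕ a < toℕ b → lookup (idPattern m) a < lookup (idPattern m) b
order-idPattern a b lt = subst₂ _<_ (sym (lookup-idPattern a)) (sym (lookup-idPattern b)) (s≤s lt)

increasing⇒contains : (w : Vec ℕ N) (ι : Fin m → Fin N) →
  StrictlyIncreasing (λ a → toℕ (ι a)) → StrictlyIncreasing (λ a → lookup w (ι a)) →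
  Contains w (idPattern m)
increasing⇒contains w ι positions values = ι , positions , λ a b → mk⇔ (forward a b) (λ lt → values a b (idPattern-order a b lt))
  where
  forward : ∀ a b → lookup w (ι a) < lookup w (ι b) → lookup (idPattern _) a < lookup (idPattern _) b
  forward a b w<w with Fin.<-cmp a b
  ... | tri< a<b _ _ = order-idPattern a b a<b
  ... | tri≈ _ refl _ = contradiction w<w (<-irrefl refl)
  ... | tri> _ _ b<a = contradiction (values b a b<a) (<-asym w<w)

contains⇒increasing : (w : Vec ℕ N) → Contains w (idPattern m) →
  Σ (Fin m → Fin N) λ ι → StrictlyIncreasing (λ a → toℕ (ι a)) × StrictlyIncreasing (λ a → lookup w (ι a))
contains⇒increasing w (ι , positions , iso) =
  ι , positions , λ a b a<b → Equivalence.from (iso a b) (order-idPattern a b a<b)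

RowsIncrease : (Fin n → Fin k → ℕ) → Set
RowsIncrease E = ∀ i → StrictlyIncreasing (E i)

ColumnsDecrease : (Fin n → Fin k → ℕ) → Set
ColumnsDecrease E = ∀ j i i' → toℕ i < toℕ i' → E i' j < E i j

Ordered : (n k : ℕ) → Vec ℕ (n * k) → Set
Ordered n k w = RowsIncrease (entry n k w) × ColumnsDecrease (entry n k w)

-- The hook.  If rows increase step by step but some column increases from
-- row i to a lower row i', the cells (i,0),…,(i,j),(i',j),…,(i',k-1) form an
-- occurrence of 12⋯(k+1).
module Hook (w : Vec ℕ (n * k))
            (row-steps : ∀ i (j j' : Fin k) → toℕ j' ≡ suc (toℕ j) → entry n k w i j < entry n k w i j')
            (i i' : Fin n) (i<i' : toℕ i < toℕ i') (j : Fin k)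
            (column-up : entry n k w i j < entry n k w i' j) where

  data HookCell (a : Fin (suc k)) : Fin n × Fin k → Set where
    upper : (c : Fin k) → toℕ a ≤ toℕ j → toℕ c ≡ toℕ a → HookCell a (i , c)
    lower : (c : Fin k) → toℕ j < toℕ a → suc (toℕ c) ≡ toℕ a → HookCell a (i' , c)

  hook : (a : Fin (suc k)) → Σ (Fin n × Fin k) (HookCell a)
  hook a with toℕ a ≤? toℕ j
  ... | yes a≤j = (i , fromℕ< (≤-<-trans a≤j (toℕ<n j))) , upper _ a≤j (toℕ-fromℕ< _)
  ... | no a≰j = lower-part a (≰⇒> a≰j)
    where
    lower-part : (a : Fin (suc k)) → toℕ j < toℕ a → Σ (Fin n × Fin k) (HookCell a)
    lower-part (suc c) j<a = (i' , c) , lower c j<a refl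

  position : Fin n × Fin k → Fin (n * k)
  position (r , c) = combine r c

  Advance : Fin n × Fin k → Fin n × Fin k → Set
  Advance p q = toℕ (position p) < toℕ (position q) × lookup w (position p) < lookup w (position q)

  row-advance : (r : Fin n) (c c' : Fin k) → toℕ c' ≡ suc (toℕ c) → Advance (r , c) (r , c')
  row-advance r c c' c'≡1+c = combine-monoʳ-< r c c' (consecutive⇒< c'≡1+c) , row-steps r c c' c'≡1+c

  turn : Advance (i , j) (i' , j)
  turn = combine-monoˡ-< j j i<i' , column-up

  turns-at-j : {a b : Fin (suc k)} → toℕ a ≤ toℕ j → toℕ j < toℕ b → toℕ b ≡ suc (toℕ a) → toℕ a ≡ toℕ j
  turns-at-j a≤j j<b b≡1+a = ≤-antisym a≤j (s≤s⁻¹ (subst (toℕ j <_) b≡1+a j<b))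

  hook-advances : ∀ {a b p q} → toℕ b ≡ suc (toℕ a) → HookCell a p → HookCell b q → Advance p q
  hook-advances b≡1+a (upper c _ c≡a) (upper c' _ c'≡b) =
    row-advance i c c' (trans c'≡b (trans b≡1+a (cong suc (sym c≡a))))
  hook-advances b≡1+a (upper c a≤j c≡a) (lower c' j<b 1+c'≡b)
    with refl ← toℕ-injective (trans c≡a (turns-at-j a≤j j<b b≡1+a))
       | refl ← toℕ-injective (trans (suc-injective (trans 1+c'≡b b≡1+a)) (turns-at-j a≤j j<b b≡1+a)) = turn
  hook-advances b≡1+a (lower _ j<a _) (upper _ b≤j _) =
    contradiction (<-trans j<a (consecutive⇒< b≡1+a)) (≤⇒≯ b≤j)
  hook-advances b≡1+a (lower c _ 1+c≡a) (lower c' _ 1+c'≡b) =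
    row-advance i' c c' (suc-injective (trans 1+c'≡b (trans b≡1+a (cong suc (sym 1+c≡a)))))

  contains : Contains w (idPattern (suc k))
  contains = increasing⇒contains w ι
      (increasing-by-steps (λ a → toℕ (ι a)) λ a b e → proj₁ (advance a b e))
      (increasing-by-steps (λ a → lookup w (ι a)) λ a b e → proj₂ (advance a b e))
    where
    ι : Fin (suc k) → Fin (n * k)
    ι a = position (proj₁ (hook a))
    advance : ∀ a b → toℕ b ≡ suc (toℕ a) → Advance (proj₁ (hook a)) (proj₁ (hook b))
    advance a b e = hook-advances e (proj₂ (hook a)) (proj₂ (hook b))

moves-right : {E : Fin n → Fin k → ℕ} → RowsIncrease E → ColumnsDecrease E →
  (i i' : Fin n) (j j' : Fin k) → toℕ (combine i j) < toℕ (combine i' j') → E i j < E i' j' →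
  toℕ j < toℕ j'
moves-right {E = E} rows columns i i' j j' before smaller with combine-lex i i' j j' before
... | inj₂ (_ , j<j') = j<j'
... | inj₁ i<i' with Fin.<-cmp j j'
...   | tri< j<j' _ _ = j<j'
...   | tri≈ _ refl _ = contradiction (columns j i i' i<i') (<-asym smaller)
...   | tri> _ _ j'<j = contradiction (<-trans (rows i' j' j j'<j) (columns j i i' i<i')) (<-asym smaller)

-- Hence an Ordered word avoids 12⋯(k+1): the columns of an occurrence would
-- strictly increase, which the pigeonhole principle forbids.
ordered⇒avoids : (w : Vec ℕ (n * k)) → Ordered n k w → Avoids w (idPattern (suc k))
ordered⇒avoids {n} {k} w (rows , columns) occurrence
  with ι , positions , values ← contains⇒increasing w occurrence =
  no-increasing-map column λ a b a<b →
    moves-right rows columns _ _ _ _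
      (subst₂ _<_ (cong toℕ (sym (split (ι a)))) (cong toℕ (sym (split (ι b)))) (positions a b a<b))
      (subst₂ _<_ (cong (lookup w) (sym (split (ι a)))) (cong (lookup w) (sym (split (ι b)))) (values a b a<b))
  where
  column : Fin (suc k) → Fin k
  column a = remainder {n} k (ι a)
  split : (p : Fin (n * k)) → combine (quotient {n} k p) (remainder {n} k p) ≡ p
  split = combine-remQuot {n} k

-- Characterisation, ⇐: an Ordered permutation lies in L_{n,k}(12⋯(k+1)).
-- (L2) holds because w_{i+1,j} < w_{i,j} < w_{i,j+1}.
ordered⇒L-avoid : (w : Vec ℕ (n * k)) → IsPerm (n * k) w → Ordered n k w → InLAvoid n k w
ordered⇒L-avoid {n} {k} w perm (rows , columns) = (perm , L1 , L2) , ordered⇒avoids w (rows , columns)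
  where
  L1 : ∀ i (j j' : Fin k) → toℕ j' ≡ suc (toℕ j) → entry n k w i j < entry n k w i j'
  L1 i j j' j'≡1+j = rows i j j' (consecutive⇒< j'≡1+j)
  L2 : ∀ (i i' : Fin n) (j j' : Fin k) → toℕ i' ≡ suc (toℕ i) → toℕ j' ≡ suc (toℕ j) →
       entry n k w i' j < entry n k w i j'
  L2 i i' j j' i'≡1+i j'≡1+j =
    <-trans (columns j i i' (consecutive⇒< i'≡1+i)) (rows i j j' (consecutive⇒< j'≡1+j))

-- Rows increase
-- by (L1); a column cannot repeat a letter (w is a permutation) and cannot
-- increase (the hook would be an occurrence of 12⋯(k+1)).
L-avoid⇒ordered : (w : Vec ℕ (n * k)) → InLAvoid n k w → Ordered n k w
L-avoid⇒ordered {n} {k} w ((perm , L1 , _) , avoids) = rows , columns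
  where
  rows : RowsIncrease (entry n k w)
  rows i = increasing-by-steps (entry n k w i) (L1 i)
  columns : ColumnsDecrease (entry n k w)
  columns j i i' i<i' with <-cmp (entry n k w i' j) (entry n k w i j)
  ... | tri< down _ _ = down
  ... | tri≈ _ same _ = contradiction (cong toℕ (proj₁ (combine-injective i' j i j (proj₂ perm _ _ same))))
                                      (λ i'≡i → <-irrefl (sym i'≡i) i<i')
  ... | tri> _ _ up = contradiction (Hook.contains w L1 i i' i<i' j up) avoids

cell : Vec (Vec ℕ k) n → Fin n → Fin k → ℕ
cell T i j = lookup (lookup T i) j

tableauOf : (n k : ℕ) → Vec ℕ (n * k) → Vec (Vec ℕ k) n
tableauOf n k w = tabulate λ i → tabulate λ j → entry n k w (opposite i) j

wordOf : Vec (Vec ℕ k) n → Vec ℕ (n * k)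
wordOf {k} {n} T = tabulate λ p → cell T (opposite (quotient {n} k p)) (remainder {n} k p)

cell-tableauOf : (w : Vec ℕ (n * k)) (i : Fin n) (j : Fin k) →
  cell (tableauOf n k w) i j ≡ entry n k w (opposite i) j
cell-tableauOf {n} {k} w i j
  rewrite lookup∘tabulate (λ i → tabulate λ j → entry n k w (opposite i) j) i =
  lookup∘tabulate (entry n k w (opposite i)) j

lookup-wordOf : (T : Vec (Vec ℕ k) n) (p : Fin (n * k)) →
  lookup (wordOf T) p ≡ cell T (opposite (quotient {n} k p)) (remainder {n} k p)
lookup-wordOf {k} {n} T = lookup∘tabulate λ p → cell T (opposite (quotient {n} k p)) (remainder {n} k p)

entry-wordOf : (T : Vec (Vec ℕ k) n) (i : Fin n) (j : Fin k) → entry n k (wordOf T) i j ≡ cell T (opposite i) j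
entry-wordOf {k} {n} T i j = trans (lookup-wordOf T (combine i j))
  (cong (λ (ij : Fin n × Fin k) → cell T (opposite (proj₁ ij)) (proj₂ ij)) (remQuot-combine i j))

wordOf-tableauOf : (w : Vec ℕ (n * k)) → wordOf (tableauOf n k w) ≡ w
wordOf-tableauOf {n} {k} w = trans (tabulate-cong same-letter) (tabulate∘lookup w)
  where
  same-letter : ∀ p → cell (tableauOf n k w) (opposite (quotient {n} k p)) (remainder {n} k p) ≡ lookup w p
  same-letter p = begin
    cell (tableauOf n k w) (opposite (quotient {n} k p)) (remainder {n} k p)
      ≡⟨ cell-tableauOf {n} {k} w _ _ ⟩
    entry n k w (opposite (opposite (quotient {n} k p))) (remainder {n} k p)
      ≡⟨ cong (λ i → entry n k w i (remainder {n} k p)) (opposite-involutive _) ⟩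
    lookup w (combine (quotient {n} k p) (remainder {n} k p))
      ≡⟨ cong (lookup w) (combine-remQuot {n} k p) ⟩
    lookup w p ∎
    where open ≡-Reasoning

tableauOf-wordOf : (T : Vec (Vec ℕ k) n) → tableauOf n k (wordOf T) ≡ T
tableauOf-wordOf {k} {n} T = trans (tabulate-cong same-row) (tabulate∘lookup T)
  where
  same-row : ∀ i → tabulate (λ j → entry n k (wordOf T) (opposite i) j) ≡ lookup T i
  same-row i = trans (tabulate-cong λ j → trans (entry-wordOf T (opposite i) j)
                                                 (cong (λ i → cell T i j) (opposite-involutive i)))
                     (tabulate∘lookup (lookup T i))

ordered⇒SYT : (w : Vec ℕ (n * k)) → IsPerm (n * k) w → Ordered n k w → IsSYTRect n k (tableauOf n k w)
ordered⇒SYT {n} {k} w (range , distinct) (rows , columns) = bounds , injective , rows′ , columns′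
  where
  bounds : ∀ i j → 1 ≤ cell (tableauOf n k w) i j × cell (tableauOf n k w) i j ≤ n * k
  bounds i j rewrite cell-tableauOf w i j = range _
  injective : ∀ i i' j j' → cell (tableauOf n k w) i j ≡ cell (tableauOf n k w) i' j' → i ≡ i' × j ≡ j'
  injective i i' j j' same
    with combine-injective _ _ _ _ (distinct _ _ (trans (sym (cell-tableauOf w i j)) (trans same (cell-tableauOf w i' j'))))
  ... | opp-i≡opp-i' , j≡j' = opposite-injective opp-i≡opp-i' , j≡j'
  rows′ : ∀ i j j' → toℕ j < toℕ j' → cell (tableauOf n k w) i j < cell (tableauOf n k w) i j'
  rows′ i j j' j<j' rewrite cell-tableauOf w i j | cell-tableauOf w i j' = rows (opposite i) j j' j<j'
  columns′ : ∀ i i' j → toℕ i < toℕ i' → cell (tableauOf n k w) i j < cell (tableauOf n k w) i' j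
  columns′ i i' j i<i' rewrite cell-tableauOf w i j | cell-tableauOf w i' j =
    columns j (opposite i') (opposite i) (opposite-reverses i i' i<i')

SYT⇒ordered : (T : Vec (Vec ℕ k) n) → IsSYTRect n k T → IsPerm (n * k) (wordOf T) × Ordered n k (wordOf T)
SYT⇒ordered {k} {n} T (bounds , injective , rows , columns) = (range , distinct) , rows′ , columns′
  where
  range : ∀ p → 1 ≤ lookup (wordOf T) p × lookup (wordOf T) p ≤ n * k
  range p rewrite lookup-wordOf T p = bounds _ _
  distinct : ∀ p q → lookup (wordOf T) p ≡ lookup (wordOf T) q → p ≡ q
  distinct p q same
    with injective _ _ _ _ (trans (sym (lookup-wordOf T p)) (trans same (lookup-wordOf T q)))
  ... | opp-q≡opp-q' , r≡r' = begin
    p                                                   ≡⟨ sym (combine-remQuot {n} k p) ⟩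
    combine (quotient {n} k p) (remainder {n} k p)       ≡⟨ cong₂ combine (opposite-injective opp-q≡opp-q') r≡r' ⟩
    combine (quotient {n} k q) (remainder {n} k q)       ≡⟨ combine-remQuot {n} k q ⟩
    q                                                   ∎
    where open ≡-Reasoning
  rows′ : RowsIncrease (entry n k (wordOf T))
  rows′ i j j' j<j' rewrite entry-wordOf T i j | entry-wordOf T i j' = rows (opposite i) j j' j<j'
  columns′ : ColumnsDecrease (entry n k (wordOf T))
  columns′ j i i' i<i' rewrite entry-wordOf T i j | entry-wordOf T i' j =
    columns (opposite i') (opposite i) j (opposite-reverses i i' i<i')

proposition3p1 : (n k : ℕ) → 1 ≤ n → 1 ≤ k →
    SubsetBijection (InLAvoid n k) (IsSYTRect n k)
proposition3p1 n k _ _ = record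
  { to      = λ { (w , inL) → tableauOf n k w , ordered⇒SYT w (proj₁ (proj₁ inL)) (L-avoid⇒ordered w inL) }
  ; from    = λ { (T , syt) → let perm , ordered = SYT⇒ordered T syt in
                              wordOf T , ordered⇒L-avoid (wordOf T) perm ordered }
  ; from-to = λ { (w , _) → wordOf-tableauOf {n} {k} w }
  ; to-from = λ { (T , _) → tableauOf-wordOf T }
  }
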